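{- Let $L$ be a complete lattice, $\Sigma$ a set and $\mu:L\to{\cal P}(\Sigma)$ a Cartan map. The following are equivalent: (i) for every $A\subseteq L$ and every $p\in S_\oplus(A)$ there exists $c_p\in L_\oplus(A)$ with $p\in\mu(c_p)$; (ii) for every $A\subseteq L$, $L_\oplus(A)=\emptyset$ implies $S_\oplus(A)=\emptyset$; (iii) for every $A\subseteq L$ such that $\bigvee A$ is distributive, $S_\oplus(A)=\emptyset$; (iv) for every $A\subseteq L$ such that $\bigvee A$ is distributive and every $p\in\Sigma$, $S(p)=\bigvee A$ implies $p\notin S_\oplus(A)$; (v) for every $A\subseteq L$ and every $p\in\Sigma$, $S(p)=\bigvee A$ implies $S(p)\in A$; (vi) for every $p\in\Sigma$, either $S(p)$ is an atom of $L$, or there exists $a\in L$ with $0<a$, $a$ covered by $S(p)$, and $\{c\in L\mid c<S(p)\}={\downarrow}a$.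
   Context: A Cartan map is a map $\mu:L\to{\cal P}(\Sigma)$ from a complete lattice $L$ to the powerset of a set $\Sigma$ that is injective, preserves arbitrary infima ($\mu(\bigwedge B)=\bigcap_{b\in B}\mu(b)$, in particular $\mu(1)=\Sigma$) and satisfies $\mu(0)=\emptyset$. For $A\subseteq L$: $\bigcup\mu[A]=\bigcup_{a\in A}\mu(a)$, $S_\oplus(A)=\mu(\bigvee A)\setminus\bigcup\mu[A]$, $L_\oplus(A)=\{c\in L\mid c<\bigvee A,\ \mu(c)\not\subseteq\bigcup\mu[A]\}$; $\bigvee A$ is distributive if $b\wedge\bigvee A=\bigvee_{a\in A}(b\wedge a)$ for all $b\in L$. For $p\in\Sigma$, $S(p)=\bigwedge\{a\in L\mid p\in\mu(a)\}$. "$a$ is covered by $b$" means $a<b$ and every $c<b$ satisfies $c\le a$. ${\downarrow}a=\{c\in L\mid c\le a\}$. -}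

module Defs where

open import Level using (Level; 0ℓ) renaming (suc to lsuc)
open import Data.Product using (Σ; ∃; _×_; _,_)
open import Data.Sum using (_⊎_)
open import Data.Empty using (⊥)
open import Relation.Nullary using (¬_)
open import Relation.Binary.PropositionalEquality using (_≡_)
open import Function.Bundles using (_⇔_)

Subset : Set → Set₁
Subset X = X → Set

record CompleteLattice : Set₂ where
  infix 4 _≤_ _<_
  field
    Carrier   : Set
    _≤_       : Carrier → Carrier → Set
    ≤-refl    : ∀ {a} → a ≤ a
    ≤-trans   : ∀ {a b c} → a ≤ b → b ≤ c → a ≤ c
    ≤-antisym : ∀ {a b} → a ≤ b → b ≤ a → a ≡ b
    ⋁         : Subset Carrier → Carrier
    ⋁-upper   : ∀ (A : Subset Carrier) {a} → A a → a ≤ ⋁ A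
    ⋁-least   : ∀ (A : Subset Carrier) {u} → (∀ {a} → A a → a ≤ u) → ⋁ A ≤ u
    ⋀         : Subset Carrier → Carrier
    ⋀-lower   : ∀ (A : Subset Carrier) {a} → A a → ⋀ A ≤ a
    ⋀-greatest : ∀ (A : Subset Carrier) {l} → (∀ {a} → A a → l ≤ a) → l ≤ ⋀ A

  _<_ : Carrier → Carrier → Set
  a < b = a ≤ b × ¬ (a ≡ b)

  𝟘 : Carrier
  𝟘 = ⋁ (λ _ → ⊥)

  𝟙 : Carrier
  𝟙 = ⋀ (λ _ → ⊥)

  _∧_ : Carrier → Carrier → Carrier
  a ∧ b = ⋀ (λ x → x ≡ a ⊎ x ≡ b)

  CoveredBy : Carrier → Carrier → Set
  CoveredBy a b = a < b × (∀ c → c < b → c ≤ a)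

  Atom : Carrier → Set
  Atom a = CoveredBy 𝟘 a

  DistributiveJoin : Subset Carrier → Set
  DistributiveJoin A =
    ∀ b → b ∧ ⋁ A ≡ ⋁ (λ x → ∃ λ a → A a × x ≡ b ∧ a)

record IsCartanMap (L : CompleteLattice) (Sig : Set)
                   (μ : CompleteLattice.Carrier L → Subset Sig) : Set₁ where
  open CompleteLattice L
  field
    injective  : ∀ a b → (∀ p → μ a p ⇔ μ b p) → a ≡ b
    preserves-⋀ : ∀ (B : Subset Carrier) p → μ (⋀ B) p ⇔ (∀ b → B b → μ b p)
    μ-𝟘        : ∀ p → ¬ μ 𝟘 p

module CartanNotions (L : CompleteLattice) (Sig : Set)
                     (μ : CompleteLattice.Carrier L → Subset Sig) where
  open CompleteLattice L

  ⋃μ : Subset Carrier → Subset Sig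
  ⋃μ A p = ∃ λ a → A a × μ a p

  S⊕ : Subset Carrier → Subset Sig
  S⊕ A p = μ (⋁ A) p × ¬ ⋃μ A p

  L⊕ : Subset Carrier → Subset Carrier
  L⊕ A c = c < ⋁ A × ¬ (∀ p → μ c p → ⋃μ A p)

  S : Sig → Carrier
  S p = ⋀ (λ a → μ a p)

  condI : Set₁
  condI = ∀ (A : Subset Carrier) p → S⊕ A p → ∃ λ c → L⊕ A c × μ c p

  condII : Set₁
  condII = ∀ (A : Subset Carrier) → (∀ c → ¬ L⊕ A c) → (∀ p → ¬ S⊕ A p)

  condIII : Set₁
  condIII = ∀ (A : Subset Carrier) → DistributiveJoin A → ∀ p → ¬ S⊕ A p

  condIV : Set₁
  condIV = ∀ (A : Subset Carrier) → DistributiveJoin A →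
           ∀ p → S p ≡ ⋁ A → ¬ S⊕ A p

  condV : Set₁
  condV = ∀ (A : Subset Carrier) p → S p ≡ ⋁ A → A (S p)

  condVI : Set
  condVI = ∀ p → Atom (S p) ⊎
           (∃ λ a → 𝟘 < a × CoveredBy a (S p) × (∀ c → (c < S p) ⇔ (c ≤ a)))

module Submission where

-- Everything hinges on condition (v), which says that each S(p) is completely
-- join-irreducible, i.e. that the join of the elements strictly below S(p) is
-- not S(p).  If instead ⋁ {c | c < S(p)} = S(p), this join is distributive, has
-- empty L⊕, and still contains p in its S⊕, because p lies in no μ(c) with
-- c < S(p); this refutes (ii) and (iv).  Conversely, irreducibility of S(p)
-- makes S(p) itself the witness c_p in (i), and rules out p ∈ S⊕(A) for a
-- distributive ⋁ A, since S(p) = S(p) ∧ ⋁ A = ⋁ {S(p) ∧ a | a ∈ A}.  Condition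
-- (vi) is the order-theoretic reformulation: S(p) covers ⋁ {c | c < S(p)}.

open import Defs
open import Level using (0ℓ; suc; lift; lower)
open import Data.Product using (_×_; _,_; proj₁; proj₂; ∃)
open import Data.Sum using (_⊎_; inj₁; inj₂)
open import Relation.Nullary using (¬_; Dec; yes; no)
open import Relation.Nullary.Decidable using (map′; decidable-stable)
open import Relation.Binary.PropositionalEquality using (_≡_; _≢_; refl; sym; trans; subst)
open import Function.Base using (_∘_)
open import Function.Bundles using (_⇔_; mk⇔; Equivalence)
open import Axiom.ExcludedMiddle using (ExcludedMiddle)

module LatticeProperties (L : CompleteLattice) where
  open CompleteLattice L

  CompletelyJoinIrreducible : Carrier → Set₁
  CompletelyJoinIrreducible s = ∀ A → s ≡ ⋁ A → A s

  LowerCoverDichotomy : Carrier → Set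
  LowerCoverDichotomy s =
    Atom s ⊎ (∃ λ a → 𝟘 < a × CoveredBy a s × (∀ c → (c < s) ⇔ (c ≤ a)))

  𝟘-least : ∀ {a} → 𝟘 ≤ a
  𝟘-least = ⋁-least _ (λ ())

  ∧-lowerˡ : ∀ {a b} → a ∧ b ≤ a
  ∧-lowerˡ = ⋀-lower _ (inj₁ refl)

  ∧-lowerʳ : ∀ {a b} → a ∧ b ≤ b
  ∧-lowerʳ = ⋀-lower _ (inj₂ refl)

  ∧-greatest : ∀ {a b c} → c ≤ a → c ≤ b → c ≤ a ∧ b
  ∧-greatest c≤a c≤b = ⋀-greatest _ λ { (inj₁ refl) → c≤a ; (inj₂ refl) → c≤b }

  ≤⇒∧≡ˡ : ∀ {a b} → a ≤ b → a ∧ b ≡ a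
  ≤⇒∧≡ˡ a≤b = ≤-antisym ∧-lowerˡ (∧-greatest ≤-refl a≤b)

  ≤⇒∧≡ʳ : ∀ {a b} → a ≤ b → b ∧ a ≡ a
  ≤⇒∧≡ʳ a≤b = ≤-antisym ∧-lowerʳ (∧-greatest a≤b ≤-refl)

  ⋁<-≤ : ∀ s → ⋁ (_< s) ≤ s
  ⋁<-≤ s = ⋁-least (_< s) proj₁

  ⋁<≡-of-join : ∀ {s A} → s ≡ ⋁ A → ¬ A s → ⋁ (_< s) ≡ s
  ⋁<≡-of-join {s} {A} s≡⋁A s∉A = ≤-antisym (⋁<-≤ s)
    (subst (_≤ ⋁ (_< s)) (sym s≡⋁A) (⋁-least A λ {a} a∈A →
      ⋁-upper (_< s) (subst (a ≤_) (sym s≡⋁A) (⋁-upper A a∈A) , λ a≡s → s∉A (subst A a≡s a∈A))))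

  irreducible⇒⋁<≢ : ∀ {s} → CompletelyJoinIrreducible s → ⋁ (_< s) ≢ s
  irreducible⇒⋁<≢ {s} irr ⋁<≡s = proj₂ (irr (_< s) (sym ⋁<≡s)) refl

  ⋁<≢⇒covered : ∀ {s} → ⋁ (_< s) ≢ s → CoveredBy (⋁ (_< s)) s
  ⋁<≢⇒covered {s} ⋁<≢s = (⋁<-≤ s , ⋁<≢s) , λ c c<s → ⋁-upper (_< s) c<s

  covered⇒⋁<≢ : ∀ {a s} → CoveredBy a s → ⋁ (_< s) ≢ s
  covered⇒⋁<≢ {a} {s} ((a≤s , a≢s) , below-a) ⋁<≡s =
    a≢s (≤-antisym a≤s (subst (_≤ a) ⋁<≡s (⋁-least (_< s) λ {c} → below-a c)))

  dichotomy⇒⋁<≢ : ∀ {s} → LowerCoverDichotomy s → ⋁ (_< s) ≢ s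
  dichotomy⇒⋁<≢ (inj₁ s-atom) = covered⇒⋁<≢ s-atom
  dichotomy⇒⋁<≢ (inj₂ (_ , _ , a⋖s , _)) = covered⇒⋁<≢ a⋖s

  covered⇒<⇔≤ : ∀ {a s} → CoveredBy a s → ∀ c → (c < s) ⇔ (c ≤ a)
  covered⇒<⇔≤ {a} {s} ((a≤s , a≢s) , below-a) c = mk⇔ (below-a c)
    λ c≤a → ≤-trans c≤a a≤s , λ c≡s → a≢s (≤-antisym a≤s (subst (_≤ a) c≡s c≤a))

  module Classical (dec : (P : Set) → Dec P) where

    ⋁<≢⇒irreducible : ∀ {s} → ⋁ (_< s) ≢ s → CompletelyJoinIrreducible s
    ⋁<≢⇒irreducible ⋁<≢s A s≡⋁A =
      decidable-stable (dec _) λ s∉A → ⋁<≢s (⋁<≡-of-join s≡⋁A s∉A)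

    -- Either b lies above s, and then b ∧ c = c for every c < s; or b ∧ s is
    -- itself below s and equals b ∧ (b ∧ s).
    ⋁<-distributive : ∀ {s} → ⋁ (_< s) ≡ s → DistributiveJoin (_< s)
    ⋁<-distributive {s} ⋁<≡s b = ≤-antisym ≤-meets meets-≤
      where
      Meets : Subset Carrier
      Meets x = ∃ λ c → c < s × x ≡ b ∧ c

      meets-≤ : ⋁ Meets ≤ b ∧ ⋁ (_< s)
      meets-≤ = ⋁-least Meets λ { (c , c<s , refl) →
        ∧-greatest ∧-lowerˡ (≤-trans ∧-lowerʳ (⋁-upper (_< s) c<s)) }

      ≤-meets : b ∧ ⋁ (_< s) ≤ ⋁ Meets
      ≤-meets with dec (b ∧ ⋁ (_< s) ≡ ⋁ (_< s))
      ... | yes b∧⋁≡⋁ = subst (_≤ ⋁ Meets) (sym b∧⋁≡⋁) (⋁-least (_< s) λ {c} c<s →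
            ⋁-upper Meets (c , c<s , sym (≤⇒∧≡ʳ
              (≤-trans (⋁-upper (_< s) c<s) (subst (_≤ b) b∧⋁≡⋁ ∧-lowerˡ)))))
      ... | no b∧⋁≢⋁ = ⋁-upper Meets (b ∧ ⋁ (_< s) , b∧⋁<s , sym (≤⇒∧≡ʳ ∧-lowerˡ))
        where
        b∧⋁<s : b ∧ ⋁ (_< s) < s
        b∧⋁<s = subst (b ∧ ⋁ (_< s) ≤_) ⋁<≡s ∧-lowerʳ , λ e → b∧⋁≢⋁ (trans e (sym ⋁<≡s))

    covered⇒dichotomy : ∀ {a s} → CoveredBy a s → LowerCoverDichotomy s
    covered⇒dichotomy {a} a⋖s with dec (a ≡ 𝟘)
    ... | yes refl = inj₁ a⋖s
    ... | no a≢𝟘 = inj₂ (a , (𝟘-least , λ 𝟘≡a → a≢𝟘 (sym 𝟘≡a)) , a⋖s , covered⇒<⇔≤ a⋖s)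

module CartanProperties (L : CompleteLattice) (Sig : Set)
                        (μ : CompleteLattice.Carrier L → Subset Sig)
                        (cartan : IsCartanMap L Sig μ) where
  open CompleteLattice L
  open CartanNotions L Sig μ
  open IsCartanMap cartan
  open LatticeProperties L hiding (module Classical)

  μ-S : ∀ p → μ (S p) p
  μ-S p = Equivalence.from (preserves-⋀ (λ a → μ a p) p) (λ _ p∈μa → p∈μa)

  S-least : ∀ {p c} → μ c p → S p ≤ c
  S-least = ⋀-lower _

  μ-monotone : ∀ {a b p} → a ≤ b → μ a p → μ b p
  μ-monotone {a} {b} {p} a≤b p∈μa =
    Equivalence.to (preserves-⋀ _ p) (subst (λ x → μ x p) (sym (≤⇒∧≡ˡ a≤b)) p∈μa) b (inj₂ refl)

  ¬μ-below-S : ∀ {p c} → c < S p → ¬ μ c p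
  ¬μ-below-S (c≤Sp , c≢Sp) p∈μc = c≢Sp (≤-antisym c≤Sp (S-least p∈μc))

  S⊕-below-S : ∀ {p} → ⋁ (_< S p) ≡ S p → S⊕ (_< S p) p
  S⊕-below-S {p} ⋁<≡Sp = subst (λ x → μ x p) (sym ⋁<≡Sp) (μ-S p)
                       , λ { (c , c<Sp , p∈μc) → ¬μ-below-S c<Sp p∈μc }

  L⊕-below-empty : ∀ {s} → ⋁ (_< s) ≡ s → ∀ c → ¬ L⊕ (_< s) c
  L⊕-below-empty ⋁<≡s c (c<⋁ , μc⊈) =
    μc⊈ λ q q∈μc → c , subst (c <_) ⋁<≡s c<⋁ , q∈μc

  condV⇒⋁<≢ : condV → ∀ p → ⋁ (_< S p) ≢ S p
  condV⇒⋁<≢ V p = irreducible⇒⋁<≢ λ A Sp≡⋁A → V A p Sp≡⋁A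

  S⊕-irreducible-empty : ∀ {A p} → DistributiveJoin A →
    CompletelyJoinIrreducible (S p) → ¬ S⊕ A p
  S⊕-irreducible-empty {A} {p} distributive irr (p∈μ⋁A , p∉⋃μA)
    with irr _ (trans (sym (≤⇒∧≡ˡ (S-least p∈μ⋁A))) (distributive (S p)))
  ... | a , a∈A , Sp≡Sp∧a = p∉⋃μA (a , a∈A , μ-monotone (subst (_≤ a) (sym Sp≡Sp∧a) ∧-lowerʳ) (μ-S p))

  condI⇒condII : condI → condII
  condI⇒condII I A L⊕-empty p p∈S⊕A with I A p p∈S⊕A
  ... | c , c∈L⊕A , _ = L⊕-empty c c∈L⊕A

  condIII⇒condIV : condIII → condIV
  condIII⇒condIV III A distributive p _ = III A distributive p

  condV⇒condIII : condV → condIII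
  condV⇒condIII V A distributive p = S⊕-irreducible-empty distributive λ B → V B p

  condV⇒condI : condV → condI
  condV⇒condI V A p (p∈μ⋁A , p∉⋃μA) =
    S p , ((S-least p∈μ⋁A , λ Sp≡⋁A → p∉⋃μA (S p , V A p Sp≡⋁A , μ-S p))
          , λ μSp⊆⋃μA → p∉⋃μA (μSp⊆⋃μA p (μ-S p)))
        , μ-S p

  module Classical (dec : (P : Set) → Dec P) where
    open LatticeProperties.Classical L dec

    ⋁<≢⇒condV : (∀ p → ⋁ (_< S p) ≢ S p) → condV
    ⋁<≢⇒condV ⋁<≢ A p = ⋁<≢⇒irreducible (⋁<≢ p) A

    condII⇒condV : condII → condV
    condII⇒condV II = ⋁<≢⇒condV λ p ⋁<≡Sp →
      II (_< S p) (L⊕-below-empty ⋁<≡Sp) p (S⊕-below-S ⋁<≡Sp)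

    condI⇒condV : condI → condV
    condI⇒condV = condII⇒condV ∘ condI⇒condII

    condIV⇒condV : condIV → condV
    condIV⇒condV IV = ⋁<≢⇒condV λ p ⋁<≡Sp →
      IV (_< S p) (⋁<-distributive ⋁<≡Sp) p (sym ⋁<≡Sp) (S⊕-below-S ⋁<≡Sp)

    condVI⇒condV : condVI → condV
    condVI⇒condV VI = ⋁<≢⇒condV λ p → dichotomy⇒⋁<≢ (VI p)

    condV⇒condVI : condV → condVI
    condV⇒condVI V p = covered⇒dichotomy (⋁<≢⇒covered (condV⇒⋁<≢ V p))

proposition9 : ExcludedMiddle (suc 0ℓ) →
    (L : CompleteLattice) (Sig : Set) (μ : CompleteLattice.Carrier L → Subset Sig) →
    IsCartanMap L Sig μ →
    let open CartanNotions L Sig μ in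
    (condI ⇔ condII) × (condI ⇔ condIII) × (condI ⇔ condIV) ×
    (condI ⇔ condV) × (condI ⇔ condVI)
proposition9 em L Sig μ cartan =
    mk⇔ condI⇒condII (condV⇒condI ∘ condII⇒condV)
  , mk⇔ (condV⇒condIII ∘ condI⇒condV) (condV⇒condI ∘ condIV⇒condV ∘ condIII⇒condIV)
  , mk⇔ (condIII⇒condIV ∘ condV⇒condIII ∘ condI⇒condV) (condV⇒condI ∘ condIV⇒condV)
  , mk⇔ condI⇒condV condV⇒condI
  , mk⇔ (condV⇒condVI ∘ condI⇒condV) (condV⇒condI ∘ condVI⇒condV)
  where
  open CartanProperties L Sig μ cartan
  open Classical (λ P → map′ lower lift em)
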